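{- Let $T$ be a tree and $\underline C=\{C_t:t\in T\}$ a ladder system on $T$. If $\underline C$ is transitive and $Chr(X_{\underline C})>\omega$, then $X_{\underline C}\to(K_{\omega+1})^1_\omega$.
   Context: A tree is a partial order $(T,\leq)$ in which $t^\downarrow=\{s\in T:s<t\}$ is well ordered for every $t$. A ladder system on $T$ is a family $\underline C=\{C_t:t\in T\}$ with $C_t\subseteq t^\downarrow$ either finite or a cofinal subset of $t^\downarrow$ of order type $\omega$. $X_{\underline C}$ is the graph with vertex set $T$ and edges $\{s,t\}$ for $t\in T$, $s\in C_t$. $\underline C$ is transitive if $C_t\cap s^\downarrow\subseteq C_s$ for all $t\in T$ and $s\in C_t$. $Chr$ denotes chromatic number. For a subgraph $X$ of the comparability graph of $T$, $X\to(K_{\omega+1})^1_\omega$ means: for every $f:T\to\omega$ there are $n\in\omega$ and a set $A\subseteq f^{ -1}(n)$ of $<_T$-order type $\omega+1$ which spans a complete subgraph of $X$. -}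

module Defs where

open import Level using (0ℓ)
open import Data.Nat using (ℕ; suc) renaming (_<_ to _<ℕ_)
open import Data.Product using (Σ; ∃; _×_; _,_)
open import Data.Sum using (_⊎_)
open import Data.Empty using (⊥)
open import Data.List using (List)
open import Data.List.Membership.Propositional using (_∈_)
open import Relation.Nullary using (¬_)
open import Relation.Binary.PropositionalEquality using (_≡_; _≢_)
open import Induction.WellFounded using (WellFounded)
open import Function.Bundles using (_⇔_)

-- A tree: a set T with a strict partial order _<_ such that for every t
-- the set t↓ = {s : s < t} is well ordered (linearly ordered and
-- well founded; well-foundedness of every t↓ is equivalent to
-- well-foundedness of _<_ on all of T).
record Tree : Set₁ where
  field
    Carrier    : Set
    _<_        : Carrier → Carrier → Set
    irrefl     : ∀ {t} → ¬ (t < t)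
    trans      : ∀ {r s t} → r < s → s < t → r < t
    pred-total : ∀ {s s′ t} → s < t → s′ < t → (s < s′) ⊎ (s ≡ s′) ⊎ (s′ < s)
    wf         : WellFounded _<_

module _ (T : Tree) where
  open Tree T renaming (Carrier to V)

  _≤_ : V → V → Set
  s ≤ t = (s < t) ⊎ (s ≡ t)

  -- C t s means s ∈ C_t.
  -- C_t is finite: it is exactly the set of members of some list.
  FiniteLadder : (V → Set) → Set
  FiniteLadder Ct = Σ (List V) λ l → ∀ s → Ct s ⇔ (s ∈ l)

  -- C_t is a cofinal subset of t↓ of order type ω: it is enumerated by a
  -- strictly increasing sequence, and every element of t↓ lies below
  -- (or equals) some element of C_t.
  OmegaLadder : V → (V → Set) → Set
  OmegaLadder t Ct = Σ (ℕ → V) λ c →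
      (∀ n → c n < c (suc n))
    × (∀ s → Ct s ⇔ (∃ λ n → c n ≡ s))
    × (∀ s → s < t → ∃ λ n → s ≤ c n)

  record LadderSystem : Set₁ where
    field
      C     : V → V → Set
      below : ∀ {t s} → C t s → s < t
      shape : ∀ t → FiniteLadder (C t) ⊎ OmegaLadder t (C t)

  module _ (L : LadderSystem) where
    open LadderSystem L

    Edge : V → V → Set
    Edge s t = C t s ⊎ C s t

    Transitive : Set
    Transitive = ∀ t s → C t s → ∀ r → C t r → r < s → C s r

    ProperColouring : (V → ℕ) → Set
    ProperColouring f = ∀ s t → Edge s t → f s ≢ f t

    ChrAboveOmega : Set
    ChrAboveOmega = ¬ (Σ (V → ℕ) ProperColouring)

    -- X_C → (K_{ω+1})^1_ω: for every f : T → ω there are n and a set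
    -- A = {a 0 < a 1 < ...} ∪ {b} (of <_T-order type ω+1) inside f⁻¹(n)
    -- spanning a complete subgraph of X_C.
    ArrowsKω+1 : Set
    ArrowsKω+1 = ∀ (f : V → ℕ) → ∃ λ n → Σ (ℕ → V) λ a → Σ V λ b →
        (∀ i → a i < a (suc i))
      × (∀ i → a i < b)
      × (∀ i → f (a i) ≡ n) × (f b ≡ n)
      × (∀ i j → i <ℕ j → Edge (a i) (a j))
      × (∀ i → Edge (a i) b)

-- If f admits no monochromatic K_{ω+1}, then for every t only finitely many
-- s ∈ C_t have the colour of t: an ω-ladder with infinitely many such points
-- would, by transitivity of C, already be a monochromatic K_ω below t, and t
-- completes it to a K_{ω+1}.  The finitely many same-coloured ladder points
-- give a well-founded, finitely branching relation, hence a rank r into ℕ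
-- that increases along it, and t ↦ (f t, r t) is a proper ω-colouring of X_C.
module Submission where

open import Defs
open import Level using (0ℓ)
open import Axiom.ExcludedMiddle using (ExcludedMiddle)
open import Data.Nat using (ℕ; zero; suc; s≤s; _+_; _*_; _<?_) renaming (_<_ to _<ℕ_; _≤_ to _≤ℕ_)
open import Data.Nat.Properties
  using (m<1+n⇒m<n∨m≡n; m≤m+n; m≤n+m; ≤-trans; ≮⇒≥; <⇒≢; *-cancelˡ-≡; +-cancelʳ-≡)
open import Data.Nat.Divisibility using (_∣_; m∣m*n; ∣m+n∣m⇒∣n; ∣1⇒≡1)
open import Data.Nat.ListAction using (sum)
open import Data.Product using (Σ; ∃; _×_; _,_; proj₁; proj₂)
open import Data.Sum using (_⊎_; inj₁; inj₂)
open import Data.Empty using (⊥-elim)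
open import Data.List using (List; _∷_; map; applyUpTo)
open import Data.List.Relation.Unary.Any using (here; there)
open import Data.List.Membership.Propositional using (_∈_; mapWith∈)
open import Data.List.Membership.Propositional.Properties
  using (mapWith∈-cong; mapWith∈≗map; ∈-map⁺; ∈-applyUpTo⁺; ∈-applyUpTo⁻)
open import Relation.Nullary using (¬_; yes; no)
open import Relation.Binary using (Rel)
open import Relation.Binary.PropositionalEquality using (_≡_; _≢_; refl; sym; trans; subst; cong)
open import Induction.WellFounded using (WellFounded; module All; module FixPoint)
open import Function.Base using (_∘_)
open import Function.Bundles using (Equivalence)

-- pair a b = 2^a (2b + 1)
pair : ℕ → ℕ → ℕ
pair zero    b = 2 * b + 1
pair (suc a) b = 2 * pair a b

odd≢even : ∀ b x → 2 * b + 1 ≢ 2 * x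
odd≢even b x eq with ∣1⇒≡1 (∣m+n∣m⇒∣n (subst (2 ∣_) (sym eq) (m∣m*n x)) (m∣m*n b))
... | ()

pair-injective : ∀ a b a′ b′ → pair a b ≡ pair a′ b′ → a ≡ a′ × b ≡ b′
pair-injective zero    b zero     b′ eq = refl , *-cancelˡ-≡ b b′ 2 (+-cancelʳ-≡ _ _ _ eq)
pair-injective zero    b (suc a′) b′ eq = ⊥-elim (odd≢even b (pair a′ b′) eq)
pair-injective (suc a) b zero     b′ eq = ⊥-elim (odd≢even b′ (pair a b) (sym eq))
pair-injective (suc a) b (suc a′) b′ eq with pair-injective a b a′ b′ (*-cancelˡ-≡ (pair a b) (pair a′ b′) 2 eq)
... | refl , b≡b′ = refl , b≡b′

∈⇒≤sum : ∀ {n ns} → n ∈ ns → n ≤ℕ sum ns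
∈⇒≤sum {ns = m ∷ ns} (here refl)  = m≤m+n m (sum ns)
∈⇒≤sum {ns = m ∷ ns} (there n∈ns) = ≤-trans (∈⇒≤sum n∈ns) (m≤n+m (sum ns) m)

module _ {a r} {A : Set a} (_<_ : Rel A r) (<-trans : ∀ {x y z} → x < y → y < z → x < z) where

  successive⇒increasing : (s : ℕ → A) → (∀ n → s n < s (suc n)) → ∀ {i j} → i <ℕ j → s i < s j
  successive⇒increasing s step {i} {suc j} i<1+j with m<1+n⇒m<n∨m≡n i<1+j
  ... | inj₁ i<j  = <-trans (successive⇒increasing s step i<j) (step j)
  ... | inj₂ refl = step i

module _ (em : ExcludedMiddle 0ℓ) (P : ℕ → Set) where

  InfinitelyOften : Set
  InfinitelyOften = Σ (ℕ → ℕ) λ idx → (∀ i → idx i <ℕ idx (suc i)) × (∀ i → P (idx i))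

  unbounded⇒infinitelyOften : (∀ N → ∃ λ m → N ≤ℕ m × P m) → InfinitelyOften
  unbounded⇒infinitelyOften next = idx , (λ i → proj₁ (proj₂ (next (suc (idx i))))) , holds
    where
    idx : ℕ → ℕ
    idx zero    = proj₁ (next 0)
    idx (suc i) = proj₁ (next (suc (idx i)))
    holds : ∀ i → P (idx i)
    holds zero    = proj₂ (proj₂ (next 0))
    holds (suc i) = proj₂ (proj₂ (next (suc (idx i))))

  eventuallyNever⊎infinitelyOften : (∃ λ N → ∀ m → N ≤ℕ m → ¬ P m) ⊎ InfinitelyOften
  eventuallyNever⊎infinitelyOften with em {∃ λ N → ∀ m → N ≤ℕ m → ¬ P m}
  ... | yes bounded = inj₁ bounded
  ... | no unbounded = inj₂ (unbounded⇒infinitelyOften witness)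
    where
    witness : ∀ N → ∃ λ m → N ≤ℕ m × P m
    witness N with em {∃ λ m → N ≤ℕ m × P m}
    ... | yes p = p
    ... | no ¬p = ⊥-elim (unbounded (N , λ m N≤m Pm → ¬p (m , N≤m , Pm)))

PredecessorList : ∀ {a r ℓ} {A : Set a} → Rel A r → Rel A ℓ → A → Set _
PredecessorList {A = A} _<_ R t = Σ (List A) λ xs → (∀ {s} → s ∈ xs → s < t) × (∀ {s} → R s t → s ∈ xs)

module _ {a r ℓ} {A : Set a} {_<_ : Rel A r} (wf : WellFounded _<_) (R : Rel A ℓ)
  (finitelyBranching : ∀ t → PredecessorList _<_ R t)
  where

  private
    children : A → List A
    children t = proj₁ (finitelyBranching t)

    rankStep : ∀ t → (∀ {s} → s < t → ℕ) → ℕ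
    rankStep t rank< = suc (sum (mapWith∈ (children t) λ s∈ → rank< (proj₁ (proj₂ (finitelyBranching t)) s∈)))

    rankStep-ext : ∀ t {rank< rank<′ : ∀ {s} → s < t → ℕ} →
      (∀ {s} (s<t : s < t) → rank< s<t ≡ rank<′ s<t) → rankStep t rank< ≡ rankStep t rank<′
    rankStep-ext t eq = cong (λ xs → suc (sum xs)) (mapWith∈-cong (children t) _ _ λ s∈ → eq _)

    open FixPoint wf (λ _ → ℕ) rankStep rankStep-ext using (unfold-wfRec)

  rank : A → ℕ
  rank = All.wfRec wf 0ℓ (λ _ → ℕ) rankStep

  rank-unfold : ∀ t → rank t ≡ suc (sum (map rank (children t)))
  rank-unfold t = trans unfold-wfRec (cong (λ xs → suc (sum xs)) (mapWith∈≗map rank (children t)))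

  rank-increasing : ∀ {s t} → R s t → rank s <ℕ rank t
  rank-increasing {s} {t} Rst rewrite rank-unfold t =
    s≤s (∈⇒≤sum (∈-map⁺ rank (proj₂ (proj₂ (finitelyBranching t)) Rst)))

module _ (T : Tree) (L : LadderSystem T) (f : Tree.Carrier T → ℕ) where
  open Tree T renaming (Carrier to V; trans to <-trans)
  open LadderSystem L

  MonochromaticKω+1 : Set
  MonochromaticKω+1 = ∃ λ n → Σ (ℕ → V) λ a → Σ V λ b →
      (∀ i → a i < a (suc i))
    × (∀ i → a i < b)
    × (∀ i → f (a i) ≡ n) × (f b ≡ n)
    × (∀ i j → i <ℕ j → Edge T L (a i) (a j))
    × (∀ i → Edge T L (a i) b)

  SameColourLadder : V → V → Set
  SameColourLadder s t = C t s × f s ≡ f t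

  sameColourLadder⇒Kω+1 : Transitive T L → ∀ t (a : ℕ → V) → (∀ i → a i < a (suc i)) →
    (∀ i → C t (a i)) → (∀ i → f (a i) ≡ f t) → MonochromaticKω+1
  sameColourLadder⇒Kω+1 transitive t a a↑ a∈C a-colour =
    f t , a , t , a↑ , (λ i → below (a∈C i)) , a-colour , refl ,
    (λ i j i<j → inj₁ (transitive t (a j) (a∈C j) (a i) (a∈C i) (successive⇒increasing _<_ <-trans a a↑ i<j))) ,
    (λ i → inj₁ (a∈C i))

  module _ (em : ExcludedMiddle 0ℓ) (transitive : Transitive T L) (noKω+1 : ¬ MonochromaticKω+1) where

    sameColourLadder-finitelyBranching : ∀ t → PredecessorList _<_ SameColourLadder t
    sameColourLadder-finitelyBranching t = byShape (shape t)
      where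
      byShape : FiniteLadder T (C t) ⊎ OmegaLadder T t (C t) → PredecessorList _<_ SameColourLadder t
      byShape (inj₁ (xs , C⇔∈)) =
        xs , (λ s∈ → below (Equivalence.from (C⇔∈ _) s∈)) , (λ (Cts , _) → Equivalence.to (C⇔∈ _) Cts)
      byShape (inj₂ (c , c↑ , C⇔c , _)) with eventuallyNever⊎infinitelyOften em (λ m → f (c m) ≡ f t)
      ... | inj₁ (N , never) = applyUpTo c N , bounded , covered
        where
        bounded : ∀ {s} → s ∈ applyUpTo c N → s < t
        bounded s∈ with n , _ , refl ← ∈-applyUpTo⁻ c s∈ = below (Equivalence.from (C⇔c _) (n , refl))
        covered : ∀ {s} → SameColourLadder s t → s ∈ applyUpTo c N
        covered (Cts , same) with Equivalence.to (C⇔c _) Cts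
        ... | n , refl with n <? N
        ...   | yes n<N = ∈-applyUpTo⁺ c n<N
        ...   | no  n≮N = ⊥-elim (never n (≮⇒≥ n≮N) same)
      ... | inj₂ (idx , idx↑ , same) = ⊥-elim (noKω+1 (sameColourLadder⇒Kω+1 transitive t (c ∘ idx)
              (λ i → successive⇒increasing _<_ <-trans c c↑ (idx↑ i))
              (λ i → Equivalence.from (C⇔c _) (idx i , refl)) same))

    sameColourRank : V → ℕ
    sameColourRank = rank wf SameColourLadder sameColourLadder-finitelyBranching

    colouring : V → ℕ
    colouring t = pair (f t) (sameColourRank t)

    colouring-separates : ∀ {s t} → C t s → colouring s ≢ colouring t
    colouring-separates Cts eq with pair-injective _ _ _ _ eq
    ... | same , equalRank =
      <⇒≢ (rank-increasing wf SameColourLadder sameColourLadder-finitelyBranching (Cts , same)) equalRank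

    colouring-proper : ProperColouring T L colouring
    colouring-proper s t (inj₁ Cts) = colouring-separates Cts
    colouring-proper s t (inj₂ Cst) = colouring-separates Cst ∘ sym

proposition1 : ExcludedMiddle 0ℓ → (T : Tree) → (L : LadderSystem T) →
    Transitive T L → ChrAboveOmega T L → ArrowsKω+1 T L
proposition1 em T L transitive χ>ω f with em {MonochromaticKω+1 T L f}
... | yes clique = clique
... | no noClique = ⊥-elim (χ>ω (_ , colouring-proper T L f em transitive noClique))
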